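{- Let $n\in\mathbb{N}$ and $G=G(5,n)$ with vertex set $V=\{2,4,\ldots,2n\}$. Let $X=\{x\in V: x\equiv 0\pmod 4\}$, $Y=\{y\in V: y\equiv 2\pmod 4\}$, and define $A=\{x\in X: x\equiv 0\pmod 5\}$, $D=\{x\in X: x\equiv \pm1\pmod 5\}$, $E=\{x\in X: x\equiv \pm 2\pmod 5\}$, $F=\{y\in Y: y\equiv 0\pmod 5\}$, $B=\{y\in Y: y\equiv \pm1\pmod 5\}$, $C=\{y\in Y: y\equiv \pm 2\pmod 5\}$. Then there is an ordering of the vertices of $G$ such that the biadjacency matrix of $G$, with rows indexed by $F,B,C$ (in this order) and columns by $A,D,E$ (in this order), has the block form $$\begin{pmatrix}\mathbf{0}&\mathbf{1}&\mathbf{1}\\ \mathbf{1}&A_1&\mathbf{1}\\ \mathbf{1}&\mathbf{1}&A_2\end{pmatrix},$$ where $\mathbf{0}$ denotes an all-zeros block, $\mathbf{1}$ an all-ones block, and $A_1$ (rows $B$, columns $D$) and $A_2$ (rows $C$, columns $E$) are path matrices.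
   Context: For a prime $p$ and $n\in\mathbb{N}$, $G(p,n)$ is the simple graph with vertex set $\{2,4,\ldots,2n\}$ in which two distinct vertices $a,b$ are adjacent if and only if both $\frac{a+b}{2}$ and $\frac{|a-b|}{2}$ are odd positive integers neither of which equals $pk$ for an integer $k\ge 2$. The biadjacency matrix has rows indexed by vertices of $Y$ and columns by vertices of $X$, with entry $1$ exactly when they are adjacent. A path matrix is the biadjacency matrix of a path graph (with its bipartition) when the vertices of each part are listed in the order in which they occur along the path. -}

module Defs where

open import Data.Nat.Base using (ℕ; zero; suc; _+_; _*_; _≤_; _<_; _%_; ⌊_/2⌋; ∣_-_∣)
open import Data.Fin.Base using (Fin; toℕ)
open import Data.Product.Base using (Σ; ∃; _×_)
open import Data.Sum.Base using (_⊎_)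
open import Relation.Nullary.Negation.Core using (¬_)
open import Relation.Binary.PropositionalEquality.Core using (_≡_; _≢_)
open import Function.Bundles using (_⇔_)
open import Function.Definitions using (Injective)

OddPos : ℕ → Set
OddPos m = 0 < m × m % 2 ≡ 1

NotBigMult : ℕ → ℕ → Set
NotBigMult p m = ∀ k → 2 ≤ k → m ≢ p * k

IsVertex : ℕ → ℕ → Set
IsVertex n v = v % 2 ≡ 0 × 2 ≤ v × v ≤ 2 * n

-- Adjacency in G(p,n) between two vertices a, b (both assumed in V)
Adjacent : ℕ → ℕ → ℕ → Set
Adjacent p a b =
  a ≢ b × OddPos ⌊ (a + b) /2⌋ × OddPos ⌊ ∣ a - b ∣ /2⌋
    × NotBigMult p ⌊ (a + b) /2⌋ × NotBigMult p ⌊ ∣ a - b ∣ /2⌋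

Xset Yset : ℕ → ℕ → Set
Xset n v = IsVertex n v × v % 4 ≡ 0
Yset n v = IsVertex n v × v % 4 ≡ 2

Res0 Res1 Res2 : ℕ → Set
Res0 v = v % 5 ≡ 0
Res1 v = v % 5 ≡ 1 ⊎ v % 5 ≡ 4
Res2 v = v % 5 ≡ 2 ⊎ v % 5 ≡ 3

Aset Dset Eset Fset Bset Cset : ℕ → ℕ → Set
Aset n v = Xset n v × Res0 v
Dset n v = Xset n v × Res1 v
Eset n v = Xset n v × Res2 v
Fset n v = Yset n v × Res0 v
Bset n v = Yset n v × Res1 v
Cset n v = Yset n v × Res2 v

record Ordering (S : ℕ → Set) : Set where
  field
    size  : ℕ
    elem  : Fin size → ℕ
    inj   : Injective _≡_ _≡_ elem
    onto  : ∀ v → S v ⇔ ∃ λ i → elem i ≡ v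
open Ordering public

-- Path matrix: the biadjacency matrix (rows: one part, columns: the other)
-- of a path graph, each part listed in order along the path.
-- If the path starts at a row vertex, r₀ c₀ r₁ c₁ …, then row i is adjacent
-- exactly to columns i and i-1 and #cols ∈ {#rows, #rows - 1};
-- if it starts at a column vertex, c₀ r₀ c₁ r₁ …, then row i is adjacent
-- exactly to columns i and i+1 and #rows ∈ {#cols, #cols - 1}.
-- (The path on 0 vertices gives the empty 0×0 matrix.)
PathMatrix : {r c : ℕ} → (Fin r → Fin c → Set) → Set
PathMatrix {r} {c} M =
    ((c ≡ r ⊎ suc c ≡ r)
      × (∀ i j → M i j ⇔ (toℕ j ≡ toℕ i ⊎ suc (toℕ j) ≡ toℕ i)))
  ⊎ ((r ≡ c ⊎ suc r ≡ c)
      × (∀ i j → M i j ⇔ (toℕ j ≡ toℕ i ⊎ toℕ j ≡ suc (toℕ i))))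

Block : ℕ → {S T : ℕ → Set} → (oR : Ordering S) → (oC : Ordering T)
      → Fin (size oR) → Fin (size oC) → Set
Block p oR oC i j = Adjacent p (elem oR i) (elem oC j)

{-# OPTIONS --safe #-}
module Submission where

-- For y ≡ 2 and x ≡ 0 (mod 4) both (y + x)/2 and |y − x|/2 are odd, so y and x are adjacent
-- in G(5,n) iff neither y + x nor |y − x| is a multiple of 5 other than 10. When y ≢ ±x (mod 5)
-- this always holds, which gives the blocks of ones; on F × A, y + x is a multiple of 5 above 10.
-- In B ∪ D write each vertex as |t| with t ≡ 6 (mod 10), the sign chosen so that t ≡ 6 (mod 20)
-- exactly on B (likewise C ∪ E with t ≡ 2). For a row |t| and a column |s| the pair
-- {y + x, |y − x|} is {|t + s|, |t − s|}, where 5 ∤ t + s and 5 ∣ t − s; so they are adjacent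
-- iff |t − s| = 10, and listing rows and columns by increasing t interleaves them along a path.

open import Defs
open import Data.List.Base using ([]; _∷_)
open import Data.Nat.Base hiding (Ordering)
open import Data.Nat.Properties
open import Data.Nat.DivMod
open import Data.Nat.Divisibility
open import Data.Nat.Coprimality using (Coprime; coprime?; coprime-divisor)
open import Data.Nat.Tactic.RingSolver using (solve)
open import Data.Fin.Base using (toℕ; fromℕ<)
open import Data.Fin.Properties using (toℕ-injective; toℕ<n; toℕ-fromℕ<)
open import Data.Product.Base using (Σ; _×_; _,_; ∃-syntax; proj₁; proj₂)
open import Data.Sum.Base using (_⊎_; inj₁; inj₂)
open import Data.Sum.Function.Propositional using (_⊎-⇔_)
open import Function.Base using (id; _∘_)
open import Function.Bundles using (_⇔_; mk⇔; Equivalence)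
open import Function.Construct.Composition using (_⇔-∘_)
open import Function.Construct.Symmetry using (⇔-sym)
open import Relation.Binary.PropositionalEquality
open import Relation.Nullary using (¬_; Dec; yes; no; contradiction)
open import Relation.Nullary.Decidable using (True; toWitness; from-yes; _×-dec_; _⊎-dec_; _→-dec_)
open import Relation.Unary using (Decidable)

-- Distances in ℕ

∣m+n-m∣≡n : ∀ m n → ∣ m + n - m ∣ ≡ n
∣m+n-m∣≡n m n = trans (∣-∣-comm (m + n) m) (∣m-m+n∣≡n m n)

∣-∣-cancel : ∀ {x y} k u v → x ≡ k + u → y ≡ k + v → ∣ u - v ∣ ≡ ∣ x - y ∣
∣-∣-cancel k u v refl refl = sym (∣m+n-m+o∣≡∣n-o∣ k u v)

∣-∣-cancelʳ : ∀ {x y} k u → x ≡ k + u → y ≡ k → u ≡ ∣ x - y ∣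
∣-∣-cancelʳ k u refl refl = sym (∣m+n-m∣≡n k u)

∣-∣-cancelˡ : ∀ {x y} k u → x ≡ k → y ≡ k + u → u ≡ ∣ x - y ∣
∣-∣-cancelˡ k u refl refl = sym (∣m-m+n∣≡n k u)

-- With t = a - c and s = b - d read in ℤ: |t| + |s| and ||t| - |s|| are |t + s| and |t - s|.
∣a-c∣±∣b-d∣ : ∀ a b c d →
  (∣ a - c ∣ + ∣ b - d ∣ ≡ ∣ a + b - (c + d) ∣ × ∣ ∣ a - c ∣ - ∣ b - d ∣ ∣ ≡ ∣ a + d - (b + c) ∣)
  ⊎ (∣ a - c ∣ + ∣ b - d ∣ ≡ ∣ a + d - (b + c) ∣ × ∣ ∣ a - c ∣ - ∣ b - d ∣ ∣ ≡ ∣ a + b - (c + d) ∣)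
∣a-c∣±∣b-d∣ a b c d with ≤-total c a | ≤-total d b
... | inj₁ c≤a | inj₁ d≤b with m≤n⇒∃[o]m+o≡n c≤a | m≤n⇒∃[o]m+o≡n d≤b
...   | t , refl | s , refl rewrite ∣m+n-m∣≡n c t | ∣m+n-m∣≡n d s = inj₁
  ( ∣-∣-cancelʳ {x = c + t + (d + s)} (c + d) (t + s) (solve (c ∷ t ∷ d ∷ s ∷ [])) refl
  , ∣-∣-cancel {x = c + t + d} {y = d + s + c} (c + d) t s
      (solve (c ∷ t ∷ d ∷ [])) (solve (c ∷ d ∷ s ∷ [])))
∣a-c∣±∣b-d∣ a b c d | inj₁ c≤a | inj₂ b≤d with m≤n⇒∃[o]m+o≡n c≤a | m≤n⇒∃[o]m+o≡n b≤d
...   | t , refl | s , refl rewrite ∣m+n-m∣≡n c t | ∣m-m+n∣≡n b s = inj₂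
  ( ∣-∣-cancelʳ {x = c + t + (b + s)} (b + c) (t + s) (solve (c ∷ t ∷ b ∷ s ∷ [])) refl
  , ∣-∣-cancel {x = c + t + b} {y = c + (b + s)} (c + b) t s
      (solve (c ∷ t ∷ b ∷ [])) (solve (c ∷ b ∷ s ∷ [])))
∣a-c∣±∣b-d∣ a b c d | inj₂ a≤c | inj₁ d≤b with m≤n⇒∃[o]m+o≡n a≤c | m≤n⇒∃[o]m+o≡n d≤b
...   | t , refl | s , refl rewrite ∣m-m+n∣≡n a t | ∣m+n-m∣≡n d s = inj₂
  ( ∣-∣-cancelˡ {y = d + s + (a + t)} (a + d) (t + s) refl (solve (a ∷ t ∷ d ∷ s ∷ []))
  , trans (∣-∣-comm t s) (∣-∣-cancel {x = a + (d + s)} {y = a + t + d} (a + d) s t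
      (solve (a ∷ d ∷ s ∷ [])) (solve (a ∷ t ∷ d ∷ []))))
∣a-c∣±∣b-d∣ a b c d | inj₂ a≤c | inj₂ b≤d with m≤n⇒∃[o]m+o≡n a≤c | m≤n⇒∃[o]m+o≡n b≤d
...   | t , refl | s , refl rewrite ∣m-m+n∣≡n a t | ∣m-m+n∣≡n b s = inj₁
  ( ∣-∣-cancelˡ {y = a + t + (b + s)} (a + b) (t + s) refl (solve (a ∷ t ∷ b ∷ s ∷ []))
  , trans (∣-∣-comm t s) (∣-∣-cancel {x = a + (b + s)} {y = b + (a + t)} (a + b) s t
      (solve (a ∷ b ∷ s ∷ [])) (solve (a ∷ b ∷ t ∷ []))))

∣m-o∣≡∣n-o∣⇒m≡n∨m+n≡o+o : ∀ {m n o} → ∣ m - o ∣ ≡ ∣ n - o ∣ → m ≡ n ⊎ m + n ≡ o + o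
∣m-o∣≡∣n-o∣⇒m≡n∨m+n≡o+o {m} {n} {o} e with ∣a-c∣±∣b-d∣ m n o o
... | inj₁ (_ , gap≡) = inj₁ (+-cancelʳ-≡ o m n (∣m-n∣≡0⇒m≡n (trans (sym gap≡) (m≡n⇒∣m-n∣≡0 e))))
... | inj₂ (_ , gap≡) = inj₂ (∣m-n∣≡0⇒m≡n (trans (sym gap≡) (m≡n⇒∣m-n∣≡0 e)))

∣m-n∣+2[m⊓n]≡m+n : ∀ m n → ∣ m - n ∣ + 2 * (m ⊓ n) ≡ m + n
∣m-n∣+2[m⊓n]≡m+n m n with ≤-total m n
... | inj₁ m≤n with m≤n⇒∃[o]m+o≡n m≤n
...   | k , refl rewrite ∣m-m+n∣≡n m k | m≤n⇒m⊓n≡m m≤n = solve (m ∷ k ∷ [])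
∣m-n∣+2[m⊓n]≡m+n m n | inj₂ n≤m with m≤n⇒∃[o]m+o≡n n≤m
...   | k , refl rewrite ∣-∣-comm (n + k) n | ∣m-m+n∣≡n n k | m≥n⇒m⊓n≡n n≤m = solve (n ∷ k ∷ [])

∣∣m-n∣⇔m%d≡n%d : ∀ m n d .{{_ : NonZero d}} → d ∣ ∣ m - n ∣ ⇔ m % d ≡ n % d
∣∣m-n∣⇔m%d≡n%d m n d = mk⇔ to from
  where
  to : d ∣ ∣ m - n ∣ → m % d ≡ n % d
  to d∣∣m-n∣ with ≤-total n m
  ... | inj₁ n≤m with m≤n⇒∃[o]m+o≡n n≤m
  ...   | k , refl = %-remove-+ʳ n (subst (d ∣_) (∣m+n-m∣≡n n k) d∣∣m-n∣)
  to d∣∣m-n∣ | inj₂ m≤n with m≤n⇒∃[o]m+o≡n m≤n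
  ...   | k , refl = sym (%-remove-+ʳ m (subst (d ∣_) (∣m-m+n∣≡n m k) d∣∣m-n∣))
  from : m % d ≡ n % d → d ∣ ∣ m - n ∣
  from m%d≡n%d = divides ∣ m / d - n / d ∣ (begin
    ∣ m - n ∣                                  ≡⟨ cong₂ ∣_-_∣ (m≡m%n+[m/n]*n m d) (m≡m%n+[m/n]*n n d) ⟩
    ∣ m % d + m / d * d - n % d + n / d * d ∣  ≡⟨ cong (λ r → ∣ r + m / d * d - n % d + n / d * d ∣) m%d≡n%d ⟩
    ∣ n % d + m / d * d - n % d + n / d * d ∣  ≡⟨ ∣m+n-m+o∣≡∣n-o∣ (n % d) (m / d * d) (n / d * d) ⟩
    ∣ m / d * d - n / d * d ∣                  ≡⟨ *-distribʳ-∣-∣ d (m / d) (n / d) ⟨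
    ∣ m / d - n / d ∣ * d                      ∎)
    where open ≡-Reasoning

∣10+m*20-n*20∣≡10⇔ : ∀ m n → ∣ 10 + m * 20 - n * 20 ∣ ≡ 10 ⇔ (n ≡ m ⊎ n ≡ suc m)
∣10+m*20-n*20∣≡10⇔ zero    zero          = mk⇔ (λ _ → inj₁ refl) (λ _ → refl)
∣10+m*20-n*20∣≡10⇔ zero    (suc zero)    = mk⇔ (λ _ → inj₂ refl) (λ _ → refl)
∣10+m*20-n*20∣≡10⇔ zero    (suc (suc n)) = mk⇔ (λ ()) (λ { (inj₁ ()) ; (inj₂ ()) })
∣10+m*20-n*20∣≡10⇔ (suc m) zero          = mk⇔ (λ ()) (λ { (inj₁ ()) ; (inj₂ ()) })
∣10+m*20-n*20∣≡10⇔ (suc m) (suc n)       =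
  (suc-cong ⊎-⇔ suc-cong) ⇔-∘ ∣10+m*20-n*20∣≡10⇔ m n
  where
  suc-cong : ∀ {a b} → a ≡ b ⇔ suc a ≡ suc b
  suc-cong = mk⇔ (cong suc) suc-injective

-- Adjacency between the two parity classes

notBigMult⇔ : ∀ p {h} → 0 < h → NotBigMult p h ⇔ (p ∤ h ⊎ h ≡ p)
notBigMult⇔ p {h} 0<h = mk⇔ to from
  where
  to : NotBigMult p h → p ∤ h ⊎ h ≡ p
  to nb with p ∣? h
  ... | no p∤h = inj₁ p∤h
  ... | yes (divides zero refl) = contradiction 0<h (<-irrefl refl)
  ... | yes (divides 1 refl) = inj₂ (+-identityʳ p)
  ... | yes (divides (suc (suc k)) refl) = contradiction (*-comm (2 + k) p) (nb (2 + k) (s≤s (s≤s z≤n)))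
  from : p ∤ h ⊎ h ≡ p → NotBigMult p h
  from (inj₁ p∤h) k _ h≡p*k = p∤h (divides k (trans h≡p*k (*-comm p k)))
  from (inj₂ refl) k 2≤k h≡h*k = <⇒≢ (m<m*n h k {{>-nonZero 0<h}} 2≤k) h≡h*k

Allowed : ℕ → ℕ → Set
Allowed p m = p ∤ m ⊎ m ≡ 2 * p

half-of-m%4≡2 : ∀ m → m % 4 ≡ 2 → m ≡ 2 * ⌊ m /2⌋ × ⌊ m /2⌋ % 2 ≡ 1
half-of-m%4≡2 m m%4≡2 = subst (λ h → m ≡ 2 * h × h % 2 ≡ 1) (sym ⌊m/2⌋≡h) (m≡2h , h%2≡1)
  where
  q h : ℕ
  q = m / 4
  h = 1 + q * 2
  m≡2h : m ≡ 2 * h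
  m≡2h = trans (m≡m%n+[m/n]*n m 4) (trans (cong (_+ q * 4) m%4≡2) (regroup q))
    where
    regroup : ∀ q → 2 + q * 4 ≡ 2 * (1 + q * 2)
    regroup q = solve (q ∷ [])
  ⌊m/2⌋≡h : ⌊ m /2⌋ ≡ h
  ⌊m/2⌋≡h = trans (cong ⌊_/2⌋ (trans m≡2h (cong (h +_) (+-identityʳ h)))) (sym (n≡⌊n+n/2⌋ h))
  h%2≡1 : h % 2 ≡ 1
  h%2≡1 = [m+kn]%n≡m%n 1 q 2

oddPos-⌊m/2⌋ : ∀ m → m % 4 ≡ 2 → OddPos ⌊ m /2⌋
oddPos-⌊m/2⌋ m m%4≡2 with ⌊ m /2⌋ | proj₂ (half-of-m%4≡2 m m%4≡2)
... | suc h | odd = z<s , odd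

notBigMult-⌊m/2⌋⇔ : ∀ {p} m → Coprime p 2 → m % 4 ≡ 2 → NotBigMult p ⌊ m /2⌋ ⇔ Allowed p m
notBigMult-⌊m/2⌋⇔ {p} m p⊥2 m%4≡2 with ⌊ m /2⌋ | half-of-m%4≡2 m m%4≡2
... | h | refl , h%2≡1 =
  (∤-cong ⊎-⇔ mk⇔ (cong (2 *_)) (*-cancelˡ-≡ h p 2)) ⇔-∘ notBigMult⇔ p (h%2≡1⇒0<h h h%2≡1)
  where
  ∤-cong : p ∤ h ⇔ p ∤ 2 * h
  ∤-cong = mk⇔ (λ p∤h p∣2h → p∤h (coprime-divisor p⊥2 p∣2h))
               (λ p∤2h p∣h → p∤2h (∣n⇒∣m*n 2 p∣h))
  h%2≡1⇒0<h : ∀ h → h % 2 ≡ 1 → 0 < h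
  h%2≡1⇒0<h (suc h) _ = z<s

adjacent⇔ : ∀ {p} y x → Coprime p 2 → y % 4 ≡ 2 → x % 4 ≡ 0 →
            Adjacent p y x ⇔ (Allowed p (y + x) × Allowed p ∣ y - x ∣)
adjacent⇔ {p} y x p⊥2 y%4≡2 x%4≡0 = mk⇔
  (λ (_ , _ , _ , sum-ok , dist-ok) → Equivalence.to sum⇔ sum-ok , Equivalence.to dist⇔ dist-ok)
  (λ (sum-ok , dist-ok) → y≢x , oddPos-⌊m/2⌋ _ sum%4 , oddPos-⌊m/2⌋ _ dist%4
                              , Equivalence.from sum⇔ sum-ok , Equivalence.from dist⇔ dist-ok)
  where
  even : ∀ {v} → v % 4 % 2 ≡ 0 → 2 ∣ v
  even {v} e = m%n≡0⇒n∣m v 2 (trans (sym (m∣n⇒o%n%m≡o%m 2 4 v (divides 2 refl))) e)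
  4∣2[y⊓x] : 4 ∣ 2 * (y ⊓ x)
  4∣2[y⊓x] = *-monoʳ-∣ 2 2∣y⊓x
    where
    2∣y⊓x : 2 ∣ y ⊓ x
    2∣y⊓x with ⊓-sel y x
    ... | inj₁ y⊓x≡y rewrite y⊓x≡y = even (cong (_% 2) y%4≡2)
    ... | inj₂ y⊓x≡x rewrite y⊓x≡x = even (cong (_% 2) x%4≡0)
  sum%4 : (y + x) % 4 ≡ 2
  sum%4 = trans (%-distribˡ-+ y x 4) (cong₂ (λ a b → (a + b) % 4) y%4≡2 x%4≡0)
  dist%4 : ∣ y - x ∣ % 4 ≡ 2
  dist%4 = begin
    ∣ y - x ∣ % 4                  ≡⟨ %-remove-+ʳ ∣ y - x ∣ 4∣2[y⊓x] ⟨
    (∣ y - x ∣ + 2 * (y ⊓ x)) % 4  ≡⟨ cong (_% 4) (∣m-n∣+2[m⊓n]≡m+n y x) ⟩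
    (y + x) % 4                    ≡⟨ sum%4 ⟩
    2                              ∎
    where open ≡-Reasoning
  sum⇔ : NotBigMult p ⌊ y + x /2⌋ ⇔ Allowed p (y + x)
  sum⇔ = notBigMult-⌊m/2⌋⇔ (y + x) p⊥2 sum%4
  dist⇔ : NotBigMult p ⌊ ∣ y - x ∣ /2⌋ ⇔ Allowed p ∣ y - x ∣
  dist⇔ = notBigMult-⌊m/2⌋⇔ ∣ y - x ∣ p⊥2 dist%4
  y≢x : y ≢ x
  y≢x refl = contradiction (trans (sym y%4≡2) x%4≡0) λ ()

adjacent-∣a-c∣-∣b-d∣⇔ : ∀ {p} a b c d .{{_ : NonZero p}} → Coprime p 2 →
  ∣ a - c ∣ % 4 ≡ 2 → ∣ b - d ∣ % 4 ≡ 0 →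
  (a + b) % p ≢ (c + d) % p → (a + d) % p ≡ (b + c) % p →
  Adjacent p ∣ a - c ∣ ∣ b - d ∣ ⇔ ∣ a + d - (b + c) ∣ ≡ 2 * p
adjacent-∣a-c∣-∣b-d∣⇔ {p} a b c d p⊥2 y%4≡2 x%4≡0 a+b≢c+d a+d≡b+c =
  pair⇔ (∣a-c∣±∣b-d∣ a b c d) ⇔-∘ adjacent⇔ ∣ a - c ∣ ∣ b - d ∣ p⊥2 y%4≡2 x%4≡0
  where
  S D : ℕ
  S = ∣ a + b - (c + d) ∣
  D = ∣ a + d - (b + c) ∣
  S-allowed : Allowed p S
  S-allowed = inj₁ (λ p∣S → a+b≢c+d (Equivalence.to (∣∣m-n∣⇔m%d≡n%d (a + b) (c + d) p) p∣S))
  D-allowed⇔ : Allowed p D ⇔ D ≡ 2 * p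
  D-allowed⇔ = mk⇔ (λ { (inj₁ p∤D) → contradiction p∣D p∤D ; (inj₂ D≡2p) → D≡2p }) inj₂
    where
    p∣D : p ∣ D
    p∣D = Equivalence.from (∣∣m-n∣⇔m%d≡n%d (a + d) (b + c) p) a+d≡b+c
  pair⇔ : ∀ {s t} → (s ≡ S × t ≡ D) ⊎ (s ≡ D × t ≡ S) → (Allowed p s × Allowed p t) ⇔ D ≡ 2 * p
  pair⇔ (inj₁ (refl , refl)) =
    mk⇔ (λ (_ , ok) → Equivalence.to D-allowed⇔ ok) (λ e → S-allowed , Equivalence.from D-allowed⇔ e)
  pair⇔ (inj₂ (refl , refl)) =
    mk⇔ (λ (ok , _) → Equivalence.to D-allowed⇔ ok) (λ e → Equivalence.from D-allowed⇔ e , S-allowed)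

5⊥2 : Coprime 5 2
5⊥2 = from-yes (coprime? 5 2)

Apart : ℕ → ℕ → Set
Apart y x = (y + x) % 5 ≢ 0 × y % 5 ≢ x % 5

adjacent-apart : ∀ y x → y % 4 ≡ 2 → x % 4 ≡ 0 → Apart y x → Adjacent 5 y x
adjacent-apart y x y%4≡2 x%4≡0 (y+x≢0 , y≢x) = Equivalence.from (adjacent⇔ y x 5⊥2 y%4≡2 x%4≡0)
  ( inj₁ (λ 5∣y+x → y+x≢0 (n∣m⇒m%n≡0 (y + x) 5 5∣y+x))
  , inj₁ (λ 5∣∣y-x∣ → y≢x (Equivalence.to (∣∣m-n∣⇔m%d≡n%d y x 5) 5∣∣y-x∣)))

apart-residues : ∀ y x {a b} → y % 5 ≡ a → x % 5 ≡ b → (a + b) % 5 ≢ 0 → a ≢ b → Apart y x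
apart-residues y x refl refl a+b≢0 a≢b = (λ e → a+b≢0 (trans (sym (%-distribˡ-+ y x 5)) e)) , a≢b

apart-sym : ∀ y x → Apart y x → Apart x y
apart-sym y x (y+x≢0 , y≢x) = (λ e → y+x≢0 (trans (cong (_% 5) (+-comm y x)) e)) , (λ e → y≢x (sym e))

apart-flip : ∀ {R R′ : ℕ → Set} → (∀ x y → R′ x → R y → Apart x y) → ∀ y x → R y → R′ x → Apart y x
apart-flip apart y x r r′ = apart-sym x y (apart x y r′ r)

apart₀₁ : ∀ y x → Res0 y → Res1 x → Apart y x
apart₀₁ y x e (inj₁ e′) = apart-residues y x e e′ (λ ()) (λ ())
apart₀₁ y x e (inj₂ e′) = apart-residues y x e e′ (λ ()) (λ ())

apart₀₂ : ∀ y x → Res0 y → Res2 x → Apart y x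
apart₀₂ y x e (inj₁ e′) = apart-residues y x e e′ (λ ()) (λ ())
apart₀₂ y x e (inj₂ e′) = apart-residues y x e e′ (λ ()) (λ ())

apart₁₂ : ∀ y x → Res1 y → Res2 x → Apart y x
apart₁₂ y x (inj₁ e) (inj₁ e′) = apart-residues y x e e′ (λ ()) (λ ())
apart₁₂ y x (inj₁ e) (inj₂ e′) = apart-residues y x e e′ (λ ()) (λ ())
apart₁₂ y x (inj₂ e) (inj₁ e′) = apart-residues y x e e′ (λ ()) (λ ())
apart₁₂ y x (inj₂ e) (inj₂ e′) = apart-residues y x e e′ (λ ()) (λ ())

nonadjacent-multiples-of-5 : ∀ y x → y % 4 ≡ 2 → x % 4 ≡ 0 → y % 5 ≡ 0 → x % 5 ≡ 0 → 10 < x →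
                             ¬ Adjacent 5 y x
nonadjacent-multiples-of-5 y x y%4≡2 x%4≡0 y%5≡0 x%5≡0 10<x adj
  with proj₁ (Equivalence.to (adjacent⇔ y x 5⊥2 y%4≡2 x%4≡0) adj)
... | inj₁ 5∤y+x = 5∤y+x (m%n≡0⇒n∣m (y + x) 5
                            (trans (%-distribˡ-+ y x 5) (cong₂ (λ a b → (a + b) % 5) y%5≡0 x%5≡0)))
... | inj₂ y+x≡10 = <⇒≢ (<-≤-trans 10<x (m≤n+m x y)) (sym y+x≡10)

-- Orderings of arithmetic progressions

<m/d⇔ : ∀ {k m} d .{{_ : NonZero d}} → k < m / d ⇔ suc k * d ≤ m
<m/d⇔ {k} {m} d = mk⇔
  (λ k<m/d → ≤-trans (*-monoˡ-≤ d k<m/d) (m/n*n≤m m d))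
  (λ le → subst (_≤ m / d) (m*n/n≡m (suc k) d) (/-monoˡ-≤ d le))

termsUpTo : (d : ℕ) .{{_ : NonZero d}} → ℕ → ℕ → ℕ
termsUpTo d N r = (N + d ∸ r) / d

<termsUpTo⇔ : ∀ d .{{_ : NonZero d}} N {r k} → r ≤ d → k < termsUpTo d N r ⇔ r + k * d ≤ N
<termsUpTo⇔ d N {r} {k} r≤d = mk⇔
  (λ k<c → +-cancelˡ-≤ d _ _ (subst₂ _≤_ regroup (+-comm N d)
             (m≤o∸n⇒m+n≤o (d + k * d) r≤N+d (Equivalence.to (<m/d⇔ d) k<c))))
  (λ le → Equivalence.from (<m/d⇔ d)
             (m+n≤o⇒m≤o∸n (d + k * d) (subst₂ _≤_ (sym regroup) (+-comm d N) (+-monoʳ-≤ d le))))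
  where
  r≤N+d : r ≤ N + d
  r≤N+d = ≤-trans r≤d (m≤n+m d N)
  regroup : d + k * d + r ≡ d + (r + k * d)
  regroup = solve (d ∷ k ∷ r ∷ [])

m≤n≤1+m⇒n≡m∨n≡1+m : ∀ {m n} → m ≤ n → n ≤ suc m → n ≡ m ⊎ n ≡ suc m
m≤n≤1+m⇒n≡m∨n≡1+m m≤n n≤1+m with m≤n⇒m<n∨m≡n n≤1+m
... | inj₁ n<1+m = inj₁ (≤-antisym (s≤s⁻¹ n<1+m) m≤n)
... | inj₂ n≡1+m = inj₂ n≡1+m

termsUpTo-step : ∀ d .{{_ : NonZero d}} N a e → a + e ≤ d →
                 termsUpTo d N a ≡ termsUpTo d N (a + e) ⊎ termsUpTo d N a ≡ suc (termsUpTo d N (a + e))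
termsUpTo-step d N a e a+e≤d = m≤n≤1+m⇒n≡m∨n≡1+m
  (subst (M / d ≤_) (cong (_/ d) (sym N+d∸a≡M+e)) (/-monoˡ-≤ d (m≤m+n M e)))
  (begin
    (N + d ∸ a) / d  ≡⟨ cong (_/ d) N+d∸a≡M+e ⟩
    (M + e) / d      ≤⟨ /-monoˡ-≤ d (+-monoʳ-≤ M e≤d) ⟩
    (M + d) / d      ≡⟨ +-distrib-/-∣ʳ M (∣-refl {d}) ⟩
    M / d + d / d    ≡⟨ cong (M / d +_) (n/n≡1 d) ⟩
    M / d + 1        ≡⟨ +-comm (M / d) 1 ⟩
    suc (M / d)      ∎)
  where
  open ≤-Reasoning
  M : ℕ
  M = N + d ∸ (a + e)
  e≤d : e ≤ d
  e≤d = ≤-trans (m≤n+m e a) a+e≤d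
  e≤N+d∸a : e ≤ N + d ∸ a
  e≤N+d∸a = m+n≤o⇒m≤o∸n e (≤-trans (subst (_≤ d) (+-comm a e) a+e≤d) (m≤n+m d N))
  N+d∸a≡M+e : N + d ∸ a ≡ M + e
  N+d∸a≡M+e = trans (sym (m∸n+n≡m e≤N+d∸a)) (cong (_+ e) (∸-+-assoc (N + d) a e))

mkOrdering : ∀ {S : ℕ → Set} m (f : ℕ → ℕ) →
             (∀ {i j} → i < m → j < m → f i ≡ f j → i ≡ j) →
             (∀ {i} → i < m → S (f i)) →
             (∀ {v} → S v → ∃[ i ] i < m × f i ≡ v) →
             Ordering S
mkOrdering {S} m f f-inj f-sound f-complete = record
  { size = m
  ; elem = λ i → f (toℕ i)
  ; inj  = λ {i} {j} e → toℕ-injective (f-inj (toℕ<n i) (toℕ<n j) e)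
  ; onto = λ v → mk⇔
      (λ s → let i , i<m , fi≡v = f-complete s in fromℕ< i<m , trans (cong f (toℕ-fromℕ< i<m)) fi≡v)
      (λ (i , fi≡v) → subst S fi≡v (f-sound (toℕ<n i)))
  }

transport : ∀ {S T : ℕ → Set} → Ordering S → (∀ v → S v ⇔ T v) → Ordering T
transport o S⇔T = record
  { size = size o ; elem = elem o ; inj = inj o ; onto = λ v → onto o v ⇔-∘ ⇔-sym (S⇔T v) }

elem∈ : ∀ {S} (o : Ordering S) i → S (elem o i)
elem∈ o i = Equivalence.from (onto o (elem o i)) (i , refl)

Progression : ℕ → ℕ → Set
Progression r v = ∃[ k ] v ≡ r + k * 20

[m+k*20]%5≡m%5 : ∀ m k → (m + k * 20) % 5 ≡ m % 5
[m+k*20]%5≡m%5 m k = trans (cong (λ t → (m + t) % 5) (sym (*-assoc k 4 5))) ([m+kn]%n≡m%n m (k * 4) 5)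

∣r+[q+k]*20-q*20∣≡r+k*20 : ∀ r q k → ∣ r + (q + k) * 20 - q * 20 ∣ ≡ r + k * 20
∣r+[q+k]*20-q*20∣≡r+k*20 r q k =
  sym (∣-∣-cancelʳ {x = r + (q + k) * 20} (q * 20) (r + k * 20) (solve (r ∷ q ∷ k ∷ [])) refl)

∣r+i*20-[i+1+k]*20∣≡ℓ+k*20 : ∀ {ℓ r} i k → ℓ + r ≡ 20 → ∣ r + i * 20 - (i + suc k) * 20 ∣ ≡ ℓ + k * 20
∣r+i*20-[i+1+k]*20∣≡ℓ+k*20 {ℓ} {r} i k ℓ+r≡20 = sym (∣-∣-cancelˡ (r + i * 20) (ℓ + k * 20) refl (begin
  (i + suc k) * 20          ≡⟨ solve (i ∷ k ∷ []) ⟩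
  20 + (i + k) * 20         ≡⟨ cong (_+ (i + k) * 20) ℓ+r≡20 ⟨
  ℓ + r + (i + k) * 20      ≡⟨ solve (ℓ ∷ r ∷ i ∷ k ∷ []) ⟩
  r + i * 20 + (ℓ + k * 20) ∎))
  where open ≡-Reasoning

<-or-≥ : ∀ i q → (∃[ k ] i + suc k ≡ q) ⊎ (∃[ k ] q + k ≡ i)
<-or-≥ i q with i <? q
... | yes i<q = inj₁ (let k , e = m≤n⇒∃[o]m+o≡n i<q in k , trans (+-suc i k) e)
... | no i≮q = inj₂ (m≤n⇒∃[o]m+o≡n (≮⇒≥ i≮q))

r+i*20+r+j*20≢q*20+q*20 : ∀ r i j q → (r + r) % 5 ≢ 0 → r + i * 20 + (r + j * 20) ≢ q * 20 + q * 20
r+i*20+r+j*20≢q*20+q*20 r i j q r+r≢0[5] e = r+r≢0[5] (begin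
  (r + r) % 5                  ≡⟨ [m+k*20]%5≡m%5 (r + r) (i + j) ⟨
  (r + r + (i + j) * 20) % 5   ≡⟨ cong (_% 5) regroup ⟩
  (0 + (q + q) * 20) % 5       ≡⟨ [m+k*20]%5≡m%5 0 (q + q) ⟩
  0                            ∎)
  where
  open ≡-Reasoning
  regroup : r + r + (i + j) * 20 ≡ (q + q) * 20
  regroup = begin
    r + r + (i + j) * 20         ≡⟨ solve (r ∷ i ∷ j ∷ []) ⟩
    r + i * 20 + (r + j * 20)    ≡⟨ e ⟩
    q * 20 + q * 20              ≡⟨ *-distribʳ-+ 20 q q ⟨
    (q + q) * 20                 ∎

module Progressions (N : ℕ) where

  progression : ∀ r → r ≤ 20 → Ordering (λ v → v ≤ N × Progression r v)
  progression r r≤20 = mkOrdering (termsUpTo 20 N r) (λ k → r + k * 20)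
    (λ {i} {j} _ _ e → *-cancelʳ-≡ i j 20 (+-cancelˡ-≡ r _ _ e))
    (λ {k} k<c → Equivalence.to (<termsUpTo⇔ 20 N r≤20) k<c , k , refl)
    (λ { (v≤N , k , refl) → k , Equivalence.from (<termsUpTo⇔ 20 N r≤20) v≤N , refl })

  -- Lists the q terms of ℓ + 20ℕ up to N downwards, then r + 20ℕ upwards: as ℓ = 20 − r,
  -- entry i is |r + 20 (i − q)| read in ℤ.
  twoSided : ∀ ℓ r → ℓ + r ≡ 20 → (r + r) % 5 ≢ 0 →
             Ordering (λ v → v ≤ N × (Progression r v ⊎ Progression ℓ v))
  twoSided ℓ r ℓ+r≡20 r+r≢0[5] = mkOrdering (q + termsUpTo 20 N r) ρ ρ-inj ρ-sound ρ-complete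
    where
    q : ℕ
    q = termsUpTo 20 N ℓ
    ℓ≤20 : ℓ ≤ 20
    ℓ≤20 = m+n≤o⇒m≤o ℓ (≤-reflexive ℓ+r≡20)
    r≤20 : r ≤ 20
    r≤20 = m+n≤o⇒n≤o ℓ (≤-reflexive ℓ+r≡20)

    ρ : ℕ → ℕ
    ρ i = ∣ r + i * 20 - q * 20 ∣

    ρ-right : ∀ {i} k → q + k ≡ i → ρ i ≡ r + k * 20
    ρ-right k refl = ∣r+[q+k]*20-q*20∣≡r+k*20 r q k

    ρ-left : ∀ {i} k → i + suc k ≡ q → ρ i ≡ ℓ + k * 20
    ρ-left {i} k i+1+k≡q = subst (λ p → ∣ r + i * 20 - p * 20 ∣ ≡ ℓ + k * 20) i+1+k≡q
                                 (∣r+i*20-[i+1+k]*20∣≡ℓ+k*20 i k ℓ+r≡20)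

    ρ-inj : ∀ {i j} → i < q + termsUpTo 20 N r → j < q + termsUpTo 20 N r → ρ i ≡ ρ j → i ≡ j
    ρ-inj {i} {j} _ _ ρi≡ρj with ∣m-o∣≡∣n-o∣⇒m≡n∨m+n≡o+o ρi≡ρj
    ... | inj₁ e = *-cancelʳ-≡ i j 20 (+-cancelˡ-≡ r _ _ e)
    ... | inj₂ e = contradiction e (r+i*20+r+j*20≢q*20+q*20 r i j q r+r≢0[5])

    ρ-sound : ∀ {i} → i < q + termsUpTo 20 N r → ρ i ≤ N × (Progression r (ρ i) ⊎ Progression ℓ (ρ i))
    ρ-sound {i} i<size with <-or-≥ i q
    ... | inj₁ (k , i+1+k≡q) =
      subst (_≤ N) (sym (ρ-left k i+1+k≡q)) (Equivalence.to (<termsUpTo⇔ 20 N ℓ≤20) k<q)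
      , inj₂ (k , ρ-left k i+1+k≡q)
      where
      k<q : k < q
      k<q = subst (suc k ≤_) i+1+k≡q (m≤n+m (suc k) i)
    ... | inj₂ (k , refl) = subst (_≤ N) (sym (ρ-right k refl))
                               (Equivalence.to (<termsUpTo⇔ 20 N r≤20) (+-cancelˡ-< q k _ i<size))
                          , inj₁ (k , ρ-right k refl)

    ρ-complete : ∀ {v} → v ≤ N × (Progression r v ⊎ Progression ℓ v) →
                 ∃[ i ] i < q + termsUpTo 20 N r × ρ i ≡ v
    ρ-complete (v≤N , inj₁ (k , refl)) =
      q + k , +-monoʳ-< q (Equivalence.from (<termsUpTo⇔ 20 N r≤20) v≤N) , ρ-right k refl
    ρ-complete (v≤N , inj₂ (k , refl)) =
      q ∸ suc k , <-≤-trans (subst (q ∸ suc k <_) i+1+k≡q (m<m+n _ z<s)) (m≤m+n q _) , ρ-left k i+1+k≡q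
      where
      i+1+k≡q : q ∸ suc k + suc k ≡ q
      i+1+k≡q = m∸n+n≡m (Equivalence.from (<termsUpTo⇔ 20 N ℓ≤20) v≤N)

-- The two path blocks

adjacent-twoSided⇔ : ∀ r q q′ i j → (r + r) % 5 ≢ 0 →
  ∣ r + i * 20 - q * 20 ∣ % 4 ≡ 2 → ∣ r + 10 + j * 20 - q′ * 20 ∣ % 4 ≡ 0 →
  Adjacent 5 ∣ r + i * 20 - q * 20 ∣ ∣ r + 10 + j * 20 - q′ * 20 ∣
    ⇔ ∣ r + i * 20 + q′ * 20 - (r + 10 + j * 20 + q * 20) ∣ ≡ 10
adjacent-twoSided⇔ r q q′ i j r+r≢0[5] y%4≡2 x%4≡0 =
  adjacent-∣a-c∣-∣b-d∣⇔ (r + i * 20) (r + 10 + j * 20) (q * 20) (q′ * 20) 5⊥2 y%4≡2 x%4≡0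
    (λ e → r+r≢0[5] (trans (sym sum%5) (trans e centre%5))) (trans cross%5 (sym cross′%5))
  where
  mod5 : ∀ x m k → x ≡ m + k * 5 → x % 5 ≡ m % 5
  mod5 x m k x≡m+5k = trans (cong (_% 5) x≡m+5k) ([m+kn]%n≡m%n m k 5)
  sum%5 : (r + i * 20 + (r + 10 + j * 20)) % 5 ≡ (r + r) % 5
  sum%5 = mod5 (r + i * 20 + (r + 10 + j * 20)) (r + r) (2 + (i + j) * 4) (solve (r ∷ i ∷ j ∷ []))
  centre%5 : (q * 20 + q′ * 20) % 5 ≡ 0
  centre%5 = mod5 (q * 20 + q′ * 20) 0 (q * 4 + q′ * 4) (solve (q ∷ q′ ∷ []))
  cross%5 : (r + i * 20 + q′ * 20) % 5 ≡ r % 5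
  cross%5 = mod5 (r + i * 20 + q′ * 20) r (i * 4 + q′ * 4) (solve (r ∷ i ∷ q′ ∷ []))
  cross′%5 : (r + 10 + j * 20 + q * 20) % 5 ≡ r % 5
  cross′%5 = mod5 (r + 10 + j * 20 + q * 20) r (2 + j * 4 + q * 4) (solve (r ∷ j ∷ q ∷ []))

≡ˡ-cong : ∀ {a b c : ℕ} → a ≡ b → a ≡ c ⇔ b ≡ c
≡ˡ-cong refl = mk⇔ id id

∣t-s∣≡10⇔-aligned : ∀ r q q′ i j → q′ ≡ q →
  ∣ r + i * 20 + q′ * 20 - (r + 10 + j * 20 + q * 20) ∣ ≡ 10 ⇔ (j ≡ i ⊎ suc j ≡ i)
∣t-s∣≡10⇔-aligned r q q′ i j refl =
  (≡-sym ⊎-⇔ ≡-sym) ⇔-∘ (∣10+m*20-n*20∣≡10⇔ j i ⇔-∘ ≡ˡ-cong (begin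
    ∣ r + i * 20 + q * 20 - (r + 10 + j * 20 + q * 20) ∣
      ≡⟨ ∣-∣-cancel {x = r + i * 20 + q * 20} {y = r + 10 + j * 20 + q * 20} (r + q * 20) (i * 20) (10 + j * 20)
                    (solve (r ∷ i ∷ q ∷ [])) (solve (r ∷ j ∷ q ∷ [])) ⟨
    ∣ i * 20 - (10 + j * 20) ∣
      ≡⟨ ∣-∣-comm (i * 20) (10 + j * 20) ⟩
    ∣ 10 + j * 20 - i * 20 ∣
      ∎))
  where
  open ≡-Reasoning
  ≡-sym : ∀ {a b : ℕ} → a ≡ b ⇔ b ≡ a
  ≡-sym = mk⇔ sym sym

∣t-s∣≡10⇔-shifted : ∀ r q q′ i j → q′ ≡ suc q →
  ∣ r + i * 20 + q′ * 20 - (r + 10 + j * 20 + q * 20) ∣ ≡ 10 ⇔ (j ≡ i ⊎ j ≡ suc i)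
∣t-s∣≡10⇔-shifted r q q′ i j refl =
  ∣10+m*20-n*20∣≡10⇔ i j ⇔-∘ ≡ˡ-cong (sym
    (∣-∣-cancel {x = r + i * 20 + suc q * 20} {y = r + 10 + j * 20 + q * 20}
                (r + 10 + q * 20) (10 + i * 20) (j * 20) (solve (r ∷ i ∷ q ∷ [])) (solve (r ∷ j ∷ q ∷ []))))

sizes-aligned : ∀ {q q′ a b} → q′ ≡ q → a ≡ b ⊎ a ≡ suc b → q′ + b ≡ q + a ⊎ suc (q′ + b) ≡ q + a
sizes-aligned refl (inj₁ refl) = inj₁ refl
sizes-aligned {q} {b = b} refl (inj₂ refl) = inj₂ (sym (+-suc q b))

sizes-shifted : ∀ {q q′ a b} → q′ ≡ suc q → a ≡ b ⊎ a ≡ suc b → q + a ≡ q′ + b ⊎ suc (q + a) ≡ q′ + b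
sizes-shifted refl (inj₁ refl) = inj₂ refl
sizes-shifted {q} {b = b} refl (inj₂ refl) = inj₁ (+-suc q b)

-- Rows are the |t| with t ≡ r and columns those with t ≡ r + 10 (mod 20), for t ∈ r + 10ℤ,
-- |t| ≤ N, both listed by increasing t; rows-first (q′ ≡ q) or columns-first (q′ ≡ 1 + q).
module PathClasses (N ℓ r : ℕ) (ℓ+r≡10 : ℓ + r ≡ 10) (r+r≢0[5] : (r + r) % 5 ≢ 0) where
  open Progressions N

  RowSet ColSet : ℕ → Set
  RowSet v = v ≤ N × (Progression r v ⊎ Progression (ℓ + 10) v)
  ColSet v = v ≤ N × (Progression (r + 10) v ⊎ Progression ℓ v)

  rows : Ordering RowSet
  rows = twoSided (ℓ + 10) r (trans regroup (cong (_+ 10) ℓ+r≡10)) r+r≢0[5]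
    where
    regroup : ℓ + 10 + r ≡ ℓ + r + 10
    regroup = solve (ℓ ∷ r ∷ [])

  cols : Ordering ColSet
  cols = twoSided ℓ (r + 10) (trans (sym (+-assoc ℓ r 10)) (cong (_+ 10) ℓ+r≡10))
                   (λ e → r+r≢0[5] (trans (sym ([m+k*20]%5≡m%5 (r + r) 1)) (trans (cong (_% 5) regroup) e)))
    where
    regroup : r + r + 1 * 20 ≡ r + 10 + (r + 10)
    regroup = solve (r ∷ [])

  ℓ+10≤20 : ℓ + 10 ≤ 20
  ℓ+10≤20 = +-monoˡ-≤ 10 (subst (ℓ ≤_) ℓ+r≡10 (m≤m+n ℓ r))

  r+10≤20 : r + 10 ≤ 20
  r+10≤20 = +-monoˡ-≤ 10 (subst (r ≤_) ℓ+r≡10 (m≤n+m r ℓ))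

  module _ {S T : ℕ → Set} (S⇔ : ∀ v → RowSet v ⇔ S v) (T⇔ : ∀ v → ColSet v ⇔ T v)
           (S⇒2[4] : ∀ {v} → S v → v % 4 ≡ 2) (T⇒0[4] : ∀ {v} → T v → v % 4 ≡ 0) where

    oS : Ordering S
    oS = transport rows S⇔

    oT : Ordering T
    oT = transport cols T⇔

    q q′ : ℕ
    q = termsUpTo 20 N (ℓ + 10)
    q′ = termsUpTo 20 N ℓ

    block⇔ : ∀ i j → Block 5 oS oT i j ⇔ ∣ r + toℕ i * 20 + q′ * 20 - (r + 10 + toℕ j * 20 + q * 20) ∣ ≡ 10
    block⇔ i j = adjacent-twoSided⇔ r q q′ (toℕ i) (toℕ j) r+r≢0[5]
                   (S⇒2[4] (elem∈ oS i)) (T⇒0[4] (elem∈ oT j))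

    path : q′ ≡ q ⊎ q′ ≡ suc q →
           termsUpTo 20 N r ≡ termsUpTo 20 N (r + 10) ⊎ termsUpTo 20 N r ≡ suc (termsUpTo 20 N (r + 10)) →
           PathMatrix (Block 5 oS oT)
    path (inj₁ q′≡q)   rows≈cols = inj₁ (sizes-aligned q′≡q rows≈cols ,
                                          λ i j → ∣t-s∣≡10⇔-aligned r q q′ (toℕ i) (toℕ j) q′≡q ⇔-∘ block⇔ i j)
    path (inj₂ q′≡1+q) rows≈cols = inj₂ (sizes-shifted q′≡1+q rows≈cols ,
                                          λ i j → ∣t-s∣≡10⇔-shifted r q q′ (toℕ i) (toℕ j) q′≡1+q ⇔-∘ block⇔ i j)

    path-block : PathMatrix (Block 5 oS oT)
    path-block = path (termsUpTo-step 20 N ℓ 10 ℓ+10≤20) (termsUpTo-step 20 N r 10 r+10≤20)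

-- Residue classes modulo 20

Progression⇔residue : ∀ {r} .{{_ : NonTrivial r}} → r ≤ 20 → ∀ v → Progression r v ⇔ (2 ≤ v × v % 20 ≡ r % 20)
Progression⇔residue {r} r≤20 v = mk⇔ to from
  where
  to : Progression r v → 2 ≤ v × v % 20 ≡ r % 20
  to (k , refl) = ≤-trans (nonTrivial⇒n>1 r) (m≤m+n r (k * 20)) , [m+kn]%n≡m%n r k 20
  from : 2 ≤ v × v % 20 ≡ r % 20 → Progression r v
  from (2≤v , v%20≡r%20) with m≤n⇒m<n∨m≡n r≤20 | v / 20 | m≡m%n+[m/n]*n v 20
  ... | inj₁ r<20 | q     | v≡v%20+q*20 =
    q , trans v≡v%20+q*20 (cong (_+ q * 20) (trans v%20≡r%20 (m<n⇒m%n≡m r<20)))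
  ... | inj₂ refl | zero  | v≡v%20+0    =
    contradiction (subst (2 ≤_) (trans v≡v%20+0 (cong (_+ 0) v%20≡r%20)) 2≤v) λ ()
  ... | inj₂ refl | suc k | v≡v%20+q*20 = k , trans v≡v%20+q*20 (cong (_+ suc k * 20) v%20≡r%20)

twoProgressions⇔residues : ∀ {ℓ r} .{{_ : NonTrivial ℓ}} .{{_ : NonTrivial r}} → ℓ + r ≡ 20 → ∀ v →
  (Progression r v ⊎ Progression ℓ v) ⇔ (2 ≤ v × (v % 20 ≡ r % 20 ⊎ v % 20 ≡ ℓ % 20))
twoProgressions⇔residues {ℓ} {r} ℓ+r≡20 v =
  ×-distribˡ-⊎ ⇔-∘ (Progression⇔residue r≤20 v ⊎-⇔ Progression⇔residue ℓ≤20 v)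
  where
  ℓ≤20 : ℓ ≤ 20
  ℓ≤20 = m+n≤o⇒m≤o ℓ (≤-reflexive ℓ+r≡20)
  r≤20 : r ≤ 20
  r≤20 = m+n≤o⇒n≤o ℓ (≤-reflexive ℓ+r≡20)
  ×-distribˡ-⊎ : ∀ {A B C : Set} → ((A × B) ⊎ (A × C)) ⇔ (A × (B ⊎ C))
  ×-distribˡ-⊎ = mk⇔ (λ { (inj₁ (a , b)) → a , inj₁ b ; (inj₂ (a , c)) → a , inj₂ c })
                     (λ { (a , inj₁ b) → inj₁ (a , b) ; (a , inj₂ c) → inj₂ (a , c) })

Residues : ℕ → (ℕ → Set) → ℕ → Set
Residues k Q v = (v % 2 ≡ 0 × v % 4 ≡ k) × Q (v % 5)

residues-mod-20 : ∀ k Q v → Residues k Q v ⇔ Residues k Q (v % 20)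
residues-mod-20 k Q v
  rewrite m∣n⇒o%n%m≡o%m 2 20 v (divides 10 refl)
        | m∣n⇒o%n%m≡o%m 4 20 v (divides 5 refl)
        | m∣n⇒o%n%m≡o%m 5 20 v (divides 4 refl) = mk⇔ id id

residues? : ∀ k {Q} → Decidable Q → Decidable (Residues k Q)
residues? k Q? v = ((v % 2 ≟ 0) ×-dec (v % 4 ≟ k)) ×-dec Q? (v % 5)

-- The Chinese remainder theorem for 20 = 4 · 5, checked residue by residue.
residueTable? : ∀ k {Q R : ℕ → Set} → Decidable Q → Decidable R →
                Dec (∀ {s} → s < 20 → (Residues k Q s → R s) × (R s → Residues k Q s))
residueTable? k Q? R? = allUpTo? (λ s → (residues? k Q? s →-dec R? s) ×-dec (R? s →-dec residues? k Q? s)) 20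

classify : ∀ k {Q R : ℕ → Set} (Q? : Decidable Q) (R? : Decidable R) → {_ : True (residueTable? k Q? R?)} →
           ∀ v → Residues k Q v ⇔ R (v % 20)
classify k {Q} {R} Q? R? {table} v = mk⇔ (proj₁ row) (proj₂ row) ⇔-∘ residues-mod-20 k Q v
  where
  row : (Residues k Q (v % 20) → R (v % 20)) × (R (v % 20) → Residues k Q (v % 20))
  row = toWitness table (m%n<n v 20)

vertexClass⇔ : ∀ k {Q R P : ℕ → Set} (Q? : Decidable Q) (R? : Decidable R) → {_ : True (residueTable? k Q? R?)} →
  (∀ v → P v ⇔ (2 ≤ v × R (v % 20))) →
  ∀ n v → (v ≤ 2 * n × P v) ⇔ ((IsVertex n v × v % 4 ≡ k) × Q (v % 5))
vertexClass⇔ k {Q} {R} Q? R? {table} P⇔ n v = mk⇔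
  (λ (v≤2n , p) → let 2≤v , r = Equivalence.to (P⇔ v) p
                      (v%2≡0 , v%4≡k) , q = Equivalence.from (class v) r
                  in ((v%2≡0 , 2≤v , v≤2n) , v%4≡k) , q)
  (λ (((v%2≡0 , 2≤v , v≤2n) , v%4≡k) , q) →
     v≤2n , Equivalence.from (P⇔ v) (2≤v , Equivalence.to (class v) ((v%2≡0 , v%4≡k) , q)))
  where
  class : ∀ v → Residues k Q v ⇔ R (v % 20)
  class = classify k Q? R? {table}

±0 ±1 ±2 : ℕ → Set
±0 t = t ≡ 0
±1 t = t ≡ 1 ⊎ t ≡ 4
±2 t = t ≡ 2 ⊎ t ≡ 3

±0? : Decidable ±0
±0? t = t ≟ 0

±1? : Decidable ±1
±1? t = (t ≟ 1) ⊎-dec (t ≟ 4)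

±2? : Decidable ±2
±2? t = (t ≟ 2) ⊎-dec (t ≟ 3)

either? : ∀ a b → Decidable (λ s → s ≡ a ⊎ s ≡ b)
either? a b s = (s ≟ a) ⊎-dec (s ≟ b)

module Orderings (n : ℕ) where
  open Progressions (2 * n)
  module BD = PathClasses (2 * n) 4 6 refl (λ ())
  module CE = PathClasses (2 * n) 8 2 refl (λ ())

  oF : Ordering (Fset n)
  oF = transport (progression 10 (m≤m+n 10 10))
         (vertexClass⇔ 2 ±0? (_≟ 10) (Progression⇔residue (m≤m+n 10 10)) n)

  oA : Ordering (Aset n)
  oA = transport (progression 20 ≤-refl) (vertexClass⇔ 0 ±0? (_≟ 0) (Progression⇔residue ≤-refl) n)

  B⇔ : ∀ v → BD.RowSet v ⇔ Bset n v
  B⇔ = vertexClass⇔ 2 ±1? (either? 6 14) (twoProgressions⇔residues refl) n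

  D⇔ : ∀ v → BD.ColSet v ⇔ Dset n v
  D⇔ = vertexClass⇔ 0 ±1? (either? 16 4) (twoProgressions⇔residues refl) n

  C⇔ : ∀ v → CE.RowSet v ⇔ Cset n v
  C⇔ = vertexClass⇔ 2 ±2? (either? 2 18) (twoProgressions⇔residues refl) n

  E⇔ : ∀ v → CE.ColSet v ⇔ Eset n v
  E⇔ = vertexClass⇔ 0 ±2? (either? 12 8) (twoProgressions⇔residues refl) n

  oB : Ordering (Bset n)
  oB = transport BD.rows B⇔

  oD : Ordering (Dset n)
  oD = transport BD.cols D⇔

  oC : Ordering (Cset n)
  oC = transport CE.rows C⇔

  oE : Ordering (Eset n)
  oE = transport CE.cols E⇔

  all-ones : ∀ {R R′ : ℕ → Set} (oY : Ordering (λ v → Yset n v × R v)) (oX : Ordering (λ v → Xset n v × R′ v)) →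
             (∀ y x → R y → R′ x → Apart y x) → ∀ i j → Block 5 oY oX i j
  all-ones oY oX apart i j = adjacent-apart y x (proj₂ (proj₁ (elem∈ oY i))) (proj₂ (proj₁ (elem∈ oX j)))
                               (apart y x (proj₂ (elem∈ oY i)) (proj₂ (elem∈ oX j)))
    where
    y x : ℕ
    y = elem oY i
    x = elem oX j

  all-zeros : ∀ i j → ¬ Block 5 oF oA i j
  all-zeros i j = nonadjacent-multiples-of-5 (elem oF i) (elem oA j)
                    (proj₂ (proj₁ (elem∈ oF i))) (proj₂ (proj₁ (elem∈ oA j)))
                    (proj₂ (elem∈ oF i)) (proj₂ (elem∈ oA j))
                    (<-≤-trans (from-yes (10 <? 20)) (m≤m+n 20 (toℕ j * 20)))

theorem5p3 : (n : ℕ) →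
    Σ (Ordering (Fset n)) λ oF → Σ (Ordering (Bset n)) λ oB → Σ (Ordering (Cset n)) λ oC →
    Σ (Ordering (Aset n)) λ oA → Σ (Ordering (Dset n)) λ oD → Σ (Ordering (Eset n)) λ oE →
      (∀ i j → ¬ Block 5 oF oA i j) × (∀ i j → Block 5 oF oD i j) × (∀ i j → Block 5 oF oE i j)
      × (∀ i j → Block 5 oB oA i j) × PathMatrix (Block 5 oB oD) × (∀ i j → Block 5 oB oE i j)
      × (∀ i j → Block 5 oC oA i j) × (∀ i j → Block 5 oC oD i j) × PathMatrix (Block 5 oC oE)
theorem5p3 n =
  oF , oB , oC , oA , oD , oE ,
  all-zeros ,
  all-ones oF oD apart₀₁ ,
  all-ones oF oE apart₀₂ ,
  all-ones oB oA (apart-flip apart₀₁) ,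
  BD.path-block B⇔ D⇔ (proj₂ ∘ proj₁) (proj₂ ∘ proj₁) ,
  all-ones oB oE apart₁₂ ,
  all-ones oC oA (apart-flip apart₀₂) ,
  all-ones oC oD (apart-flip apart₁₂) ,
  CE.path-block C⇔ E⇔ (proj₂ ∘ proj₁) (proj₂ ∘ proj₁)
  where open Orderings n
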